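{- For every $\varepsilon>0$ there is $t_0$ such that for every integer $t\geq t_0$ there is $n_0$ such that for all $n\geq n_0$ the following holds. There exists a graph collection $\mathfrak{G}=(G_1,\ldots,G_{t^2})$ on vertex set $[n]$ and a function $\phi:E(K_{t,t})\to[t^2]$ such that $\delta(\mathfrak{G})\geq(1-\varepsilon)n$ and there is no copy of $K_{t,t}$ in $\bigcup_i G_i$ in which the copy of each edge $e\in E(K_{t,t})$ lies in $G_{\phi(e)}$.
   Context: A graph collection on a set $V$ is a finite sequence $(G_1,\ldots,G_m)$ of (not necessarily distinct) graphs each with vertex set $V$, and $\delta(\mathfrak{G})=\min_i\delta(G_i)$. $K_{t,t}$ is the complete bipartite graph with both parts of size $t$.
   Formalization: The parameter ε ranges over the positive rationals. -}

module Defs where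

open import Data.Nat using (ℕ; _+_; _*_; _≤_; _<_)
open import Data.Fin using (Fin)
open import Data.Bool using (Bool; true; false)
open import Data.List using (List; length; filter; allFin)
open import Data.Sum using (_⊎_; inj₁; inj₂)
open import Data.Product using (Σ; Σ-syntax; ∃; ∃-syntax; _×_; _,_)
open import Relation.Binary.PropositionalEquality using (_≡_)
open import Relation.Nullary using (¬_)
open import Relation.Nullary.Decidable using (does)
open import Data.Bool.Properties using (_≟_)
open import Function.Definitions using (Injective)

record Graph (n : ℕ) : Set where
  field
    adj    : Fin n → Fin n → Bool
    sym    : ∀ u v → adj u v ≡ adj v u
    irrefl : ∀ v → adj v v ≡ false
open Graph public

degree : ∀ {n} → Graph n → Fin n → ℕ
degree {n} G v = length (filter (λ u → adj G v u ≟ true) (allFin n))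

Collection : ℕ → ℕ → Set
Collection m n = Fin m → Graph n

-- δ(𝔊) ≥ (1 - p/q) n, written without division: for every graph G_i and
-- vertex v, q·deg_{G_i}(v) + p·n ≥ q·n (equivalent for q > 0).
MinDegreeAtLeast : ∀ {m n} → Collection m n → (p q : ℕ) → Set
MinDegreeAtLeast {m} {n} 𝔊 p q = ∀ (i : Fin m) (v : Fin n) → q * n ≤ q * degree (𝔊 i) v + p * n

-- K_{t,t} has vertex set Fin t ⊎ Fin t (left part, right part) and edge set
-- E(K_{t,t}) = Fin t × Fin t, the pair (a , b) being the edge {inj₁ a, inj₂ b}.
EdgeKtt : ℕ → Set
EdgeKtt t = Fin t × Fin t

PatternedCopy : ∀ {m n} (t : ℕ) → Collection m n → (EdgeKtt t → Fin m) → Set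
PatternedCopy {m} {n} t 𝔊 φ =
  Σ[ f ∈ (Fin t ⊎ Fin t → Fin n) ]
    (Injective _≡_ _≡_ f × (∀ (a b : Fin t) → adj (𝔊 (φ (a , b))) (f (inj₁ a)) (f (inj₂ b)) ≡ true))

{-# OPTIONS --safe #-}
-- Let k = 4q and give every colour c the graph on [n] in which u ~ w iff u ≠ w and
-- u + w ≢ s_c (mod k).  A vertex v has at most 2 + 2n/k non-neighbours (v itself, and vertices u
-- with v + u in a fixed residue class, told apart by ⌊(v + u)/k⌋), whence minimum degree
-- ≥ (1 - p/q) n once n ≥ 4q.  For t ≥ k^k + k, read the right vertex b of K_{t,t} as the code of
-- a function W_b : [k] → [k] and give the edge ab the residue W_b(a) + a.  Given any vertex map f,
-- choose b to code j ↦ f(j) mod k and then a := f(b) mod k: the image of ab has endpoint sum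
-- f(a) + f(b) ≡ W_b(a) + a, precisely the residue its graph forbids.
module Submission where

open import Defs hiding (sym)
open import Data.Nat using (ℕ; _*_; _≤_; _<_)
open import Data.Fin using (Fin)
open import Data.Product using (Σ; Σ-syntax; ∃; ∃-syntax; _×_; _,_)
open import Relation.Nullary using (¬_)

open import Data.Bool using (Bool; true; false; not; _∧_; T)
open import Data.Bool.Properties using (_≟_; ∧-zeroʳ)
open import Data.Empty using (⊥-elim)
open import Data.Fin as Fin using (zero; suc; toℕ; inject≤; finToFun; funToFin; combine; remQuot)
open import Data.Fin.Properties using (toℕ-injective; toℕ<n; toℕ-fromℕ<; toℕ-inject≤; suc-injective; remQuot-combine; finToFun-funToFin)
open import Data.List using (length; filter; tabulate)
open import Data.Nat as ℕ using (_+_; s≤s; s≤s⁻¹; _≡ᵇ_; _^_; NonZero; >-nonZero)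
open import Data.Nat.DivMod
open import Data.Nat.Solver using (module +-*-Solver)
open import Data.Nat.Properties hiding (_≟_; suc-injective)
open import Data.Product using (uncurry)
open import Data.Sum using (_⊎_; inj₁; inj₂)
open import Data.Unit using (tt)
open import Function using (_∘_; id; case_of_)
open import Relation.Nullary using (Dec; yes; no; does)
open import Relation.Binary.PropositionalEquality

record InjectsBelow {n : ℕ} (Q : Fin n → Set) (M : ℕ) : Set where
  field
    label           : Fin n → ℕ
    label<          : ∀ {u} → Q u → label u < M
    label-injective : ∀ {u w} → Q u → Q w → label u ≡ label w → u ≡ w
open InjectsBelow

module _ {n : ℕ} {Q : Fin (ℕ.suc n) → Set} where

  restrict-suc : ∀ {M} → InjectsBelow Q M → InjectsBelow (Q ∘ suc) M
  restrict-suc ι = record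
    { label           = label ι ∘ suc
    ; label<          = label< ι
    ; label-injective = λ qu qw eq → suc-injective (label-injective ι qu qw eq)
    }

  -- The element labelled M (if any) takes over the label of zero.
  remove-zero : ∀ {M} → Q zero → InjectsBelow Q (ℕ.suc M) → InjectsBelow (Q ∘ suc) M
  remove-zero {M} q₀ ι = record
    { label           = λ u → relabel (label ι (suc u) ℕ.≟ M)
    ; label<          = relabel<
    ; label-injective = relabel-injective
    }
    where
    relabel : ∀ {ℓ} → Dec (ℓ ≡ M) → ℕ
    relabel (yes _) = label ι zero
    relabel {ℓ} (no _) = ℓ

    label≢zero : ∀ {u} → Q (suc u) → label ι (suc u) ≢ label ι zero
    label≢zero qu eq with label-injective ι qu q₀ eq
    ... | ()

    relabel< : ∀ {u} → Q (suc u) → relabel (label ι (suc u) ℕ.≟ M) < M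
    relabel< {u} qu with label ι (suc u) ℕ.≟ M
    ... | yes ℓ≡M = ≤∧≢⇒< (s≤s⁻¹ (label< ι q₀)) (λ eq → label≢zero qu (trans ℓ≡M (sym eq)))
    ... | no ℓ≢M  = ≤∧≢⇒< (s≤s⁻¹ (label< ι qu)) ℓ≢M

    relabel-injective : ∀ {u w} → Q (suc u) → Q (suc w) →
      relabel (label ι (suc u) ℕ.≟ M) ≡ relabel (label ι (suc w) ℕ.≟ M) → u ≡ w
    relabel-injective {u} {w} qu qw eq with label ι (suc u) ℕ.≟ M | label ι (suc w) ℕ.≟ M
    ... | yes u≡M | yes w≡M = suc-injective (label-injective ι qu qw (trans u≡M (sym w≡M)))
    ... | yes _   | no _    = ⊥-elim (label≢zero qw (sym eq))
    ... | no _    | yes _   = ⊥-elim (label≢zero qu eq)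
    ... | no _    | no _    = suc-injective (label-injective ι qu qw eq)

length-filter-tabulate-≥ : ∀ {A : Set} {n M} (P : A → Bool) (f : Fin n → A) →
  InjectsBelow (λ u → P (f u) ≡ false) M →
  n ≤ length (filter (λ x → P x ≟ true) (tabulate f)) + M
length-filter-tabulate-≥ {n = ℕ.zero} P f ι = ℕ.z≤n
length-filter-tabulate-≥ {n = ℕ.suc n} P f ι with P (f zero) in eq
... | true = s≤s (length-filter-tabulate-≥ P (f ∘ suc) (restrict-suc ι))
length-filter-tabulate-≥ {n = ℕ.suc n} {ℕ.zero} P f ι | false = ⊥-elim (n≮0 (label< ι eq))
length-filter-tabulate-≥ {n = ℕ.suc n} {ℕ.suc M} P f ι | false =
  subst (ℕ.suc n ≤_) (sym (+-suc _ M)) (s≤s (length-filter-tabulate-≥ P (f ∘ suc) (remove-zero eq ι)))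

degree-≥ : ∀ {n M} (G : Graph n) (v : Fin n) →
  InjectsBelow (λ u → adj G v u ≡ false) M → n ≤ degree G v + M
degree-≥ G v = length-filter-tabulate-≥ (adj G v) id

%-/-injective : ∀ {m n d} .{{_ : NonZero d}} → m % d ≡ n % d → m / d ≡ n / d → m ≡ n
%-/-injective {m} {n} {d} %≡ /≡ = begin
  m                 ≡⟨ m≡m%n+[m/n]*n m d ⟩
  m % d + m / d * d ≡⟨ cong₂ (λ r q → r + q * d) %≡ /≡ ⟩
  n % d + n / d * d ≡⟨ sym (m≡m%n+[m/n]*n n d) ⟩
  n                 ∎
  where open ≡-Reasoning

toℕ-mod : ∀ {m} .{{_ : NonZero m}} (i : Fin m) → toℕ i mod m ≡ i
toℕ-mod {m} i = toℕ-injective (trans (toℕ-fromℕ< (m%n<n (toℕ i) m)) (m<n⇒m%n≡m (toℕ<n i)))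

toℕ-inject≤-mod : ∀ {m t} .{{_ : NonZero m}} (i : Fin m) .(m≤t : m ≤ t) → toℕ (inject≤ i m≤t) mod m ≡ i
toℕ-inject≤-mod {m} i m≤t = trans (cong (λ j → j mod m) (toℕ-inject≤ i m≤t)) (toℕ-mod i)

does-≟-sym : ∀ {n} (u w : Fin n) → does (u Fin.≟ w) ≡ does (w Fin.≟ u)
does-≟-sym u w with u Fin.≟ w | w Fin.≟ u
... | yes _   | yes _   = refl
... | no _    | no _    = refl
... | yes u≡w | no w≢u  = ⊥-elim (w≢u (sym u≡w))
... | no u≢w  | yes w≡u = ⊥-elim (u≢w (sym w≡u))

q*[2+[n+n]/k]≤n : ∀ {k} .{{_ : NonZero k}} q n → 4 * q ≤ k → 4 * q ≤ n → q * (2 + (n + n) / k) ≤ n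
q*[2+[n+n]/k]≤n {k} q n 4q≤k 4q≤n = *-cancelˡ-≤ 4 (begin
  4 * (q * (2 + X))       ≡⟨ solve 2 (λ q X → con 4 :* (q :* (con 2 :+ X)) := con 2 :* (con 4 :* q) :+ X :* (con 4 :* q)) refl q X ⟩
  2 * (4 * q) + X * (4 * q) ≤⟨ +-mono-≤ (*-monoʳ-≤ 2 4q≤n) (*-monoʳ-≤ X 4q≤k) ⟩
  2 * n + X * k           ≤⟨ +-monoʳ-≤ (2 * n) (m/n*n≤m (n + n) k) ⟩
  2 * n + (n + n)         ≡⟨ solve 1 (λ n → con 2 :* n :+ (n :+ n) := con 4 :* n) refl n ⟩
  4 * n                   ∎)
  where
  open ≤-Reasoning
  open +-*-Solver
  X : ℕ
  X = (n + n) / k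

module _ (k : ℕ) .{{_ : NonZero k}} where

  sumAvoiding : ∀ {n} → ℕ → Graph n
  sumAvoiding s = record
    { adj    = λ u w → not ((toℕ u + toℕ w) % k ≡ᵇ s) ∧ not (does (u Fin.≟ w))
    ; sym    = λ u w → cong₂ (λ x y → not (x % k ≡ᵇ s) ∧ not y) (+-comm (toℕ u) (toℕ w)) (does-≟-sym u w)
    ; irrefl = irrefl′
    }
    where
    irrefl′ : ∀ v → not ((toℕ v + toℕ v) % k ≡ᵇ s) ∧ not (does (v Fin.≟ v)) ≡ false
    irrefl′ v with v Fin.≟ v
    ... | yes _  = ∧-zeroʳ _
    ... | no v≢v = ⊥-elim (v≢v refl)

  sumAvoiding-nonadjacent : ∀ {n} s (u w : Fin n) → (toℕ u + toℕ w) % k ≡ s → adj (sumAvoiding s) u w ≡ false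
  sumAvoiding-nonadjacent s u w refl with (toℕ u + toℕ w) % k ≡ᵇ (toℕ u + toℕ w) % k | ≡⇒≡ᵇ ((toℕ u + toℕ w) % k) _ refl
  ... | true | _ = refl

  sumAvoiding-nonadjacent⇒ : ∀ {n} s (u w : Fin n) → adj (sumAvoiding s) u w ≡ false →
    u ≡ w ⊎ (toℕ u + toℕ w) % k ≡ s
  sumAvoiding-nonadjacent⇒ s u w nonadj with (toℕ u + toℕ w) % k ≡ᵇ s in eq | u Fin.≟ w
  ... | true  | _       = inj₂ (≡ᵇ⇒≡ _ _ (subst T (sym eq) tt))
  ... | false | yes u≡w = inj₁ u≡w
  ... | false | no _    with nonadj
  ...   | ()

  -- Non-neighbours u ≠ v of v share the residue of v + u, so they are told apart by the quotient.
  sumAvoiding-nonneighbours : ∀ {n} s (v : Fin n) →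
    InjectsBelow (λ u → adj (sumAvoiding s) v u ≡ false) (2 + (n + n) / k)
  sumAvoiding-nonneighbours {n} s v = record
    { label           = λ u → label′ (v Fin.≟ u)
    ; label<          = label′<
    ; label-injective = label′-injective
    }
    where
    X : ℕ
    X = (n + n) / k

    label′ : ∀ {u} → Dec (v ≡ u) → ℕ
    label′ (yes _)    = ℕ.suc X
    label′ {u} (no _) = (toℕ v + toℕ u) / k

    quotient≤X : ∀ u → (toℕ v + toℕ u) / k ≤ X
    quotient≤X u = /-monoˡ-≤ k (+-mono-≤ (<⇒≤ (toℕ<n v)) (<⇒≤ (toℕ<n u)))

    label′< : ∀ {u} → adj (sumAvoiding s) v u ≡ false → label′ (v Fin.≟ u) < 2 + X
    label′< {u} _ with v Fin.≟ u
    ... | yes _ = ≤-refl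
    ... | no _  = s≤s (m≤n⇒m≤1+n (quotient≤X u))

    label′-injective : ∀ {u w} → adj (sumAvoiding s) v u ≡ false → adj (sumAvoiding s) v w ≡ false →
      label′ (v Fin.≟ u) ≡ label′ (v Fin.≟ w) → u ≡ w
    label′-injective {u} {w} nu nw eq
      with v Fin.≟ u | v Fin.≟ w | sumAvoiding-nonadjacent⇒ s v u nu | sumAvoiding-nonadjacent⇒ s v w nw
    ... | yes v≡u | yes v≡w | _        | _        = trans (sym v≡u) v≡w
    ... | yes _   | no _    | _        | _        = ⊥-elim (<⇒≱ (s≤s (quotient≤X w)) (≤-reflexive eq))
    ... | no _    | yes _   | _        | _        = ⊥-elim (<⇒≱ (s≤s (quotient≤X u)) (≤-reflexive (sym eq)))
    ... | no v≢u  | no _    | inj₁ v≡u | _        = ⊥-elim (v≢u v≡u)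
    ... | no _    | no v≢w  | _        | inj₁ v≡w = ⊥-elim (v≢w v≡w)
    ... | no _    | no _    | inj₂ u%  | inj₂ w%  =
      toℕ-injective (+-cancelˡ-≡ (toℕ v) _ _ (%-/-injective (trans u% (sym w%)) eq))

  degree-sumAvoiding : ∀ {n} s (v : Fin n) → n ≤ degree (sumAvoiding s) v + (2 + (n + n) / k)
  degree-sumAvoiding s v = degree-≥ (sumAvoiding s) v (sumAvoiding-nonneighbours s v)

  sumAvoiding-minDegree : ∀ {n} p q s (v : Fin n) → 0 < p → 4 * q ≤ k → 4 * q ≤ n →
    q * n ≤ q * degree (sumAvoiding s) v + p * n
  sumAvoiding-minDegree {n} p q s v 0<p 4q≤k 4q≤n = begin
    q * n                               ≤⟨ *-monoʳ-≤ q (degree-sumAvoiding s v) ⟩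
    q * (d + (2 + (n + n) / k))         ≡⟨ *-distribˡ-+ q d _ ⟩
    q * d + q * (2 + (n + n) / k)       ≤⟨ +-monoʳ-≤ (q * d) (q*[2+[n+n]/k]≤n q n 4q≤k 4q≤n) ⟩
    q * d + n                           ≤⟨ +-monoʳ-≤ (q * d) (m≤n*m n p {{>-nonZero 0<p}}) ⟩
    q * d + p * n                       ∎
    where
    open ≤-Reasoning
    d : ℕ
    d = degree (sumAvoiding s) v

  instance
    k^k≢0 : NonZero (k ^ k)
    k^k≢0 = m^n≢0 k k

  codeColour : Fin k → Fin (k ^ k) → ℕ
  codeColour i c = (toℕ (finToFun c i) + toℕ i) % k

  codeColour-funToFin : ∀ (x : Fin k → ℕ) y →
    codeColour (y mod k) (funToFin (λ j → x j mod k)) ≡ (x (y mod k) + y) % k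
  codeColour-funToFin x y = begin
    (toℕ (finToFun (funToFin W) i) + toℕ i) % k ≡⟨ cong (λ j → (toℕ j + toℕ i) % k) (finToFun-funToFin W i) ⟩
    (toℕ (W i) + toℕ i) % k                     ≡⟨ cong₂ (λ a b → (a + b) % k) (toℕ-fromℕ< (m%n<n (x i) k)) (toℕ-fromℕ< (m%n<n y k)) ⟩
    (x i % k + y % k) % k                       ≡⟨ sym (%-distribˡ-+ (x i) y k) ⟩
    (x i + y) % k                               ∎
    where
    open ≡-Reasoning
    i : Fin k
    i = y mod k
    W : Fin k → Fin k
    W j = x j mod k

  module _ {t : ℕ} (k≤t : k ≤ t) (k^k≤t : k ^ k ≤ t) where

    -- Only a < k and b < k ^ k matter; reducing modulo k and k ^ k just makes the colouring total.
    edgeColour : Fin t → Fin t → ℕ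
    edgeColour a b = codeColour (toℕ a mod k) (toℕ b mod (k ^ k))

    collection : ∀ {n} → Collection (t * t) n
    collection c = uncurry (λ a b → sumAvoiding (edgeColour a b)) (remQuot t c)

    edgeIndex : EdgeKtt t → Fin (t * t)
    edgeIndex = uncurry combine

    collection-edgeIndex : ∀ {n} a b → collection {n} (edgeIndex (a , b)) ≡ sumAvoiding (edgeColour a b)
    collection-edgeIndex a b = cong (uncurry (λ a b → sumAvoiding (edgeColour a b))) (remQuot-combine a b)

    collection-minDegree : ∀ {n} p q → 0 < p → 4 * q ≤ k → 4 * q ≤ n → MinDegreeAtLeast (collection {n}) p q
    collection-minDegree p q 0<p 4q≤k 4q≤n c v = sumAvoiding-minDegree p q _ v 0<p 4q≤k 4q≤n

    ¬patternedCopy : ∀ {n} → ¬ PatternedCopy t (collection {n}) edgeIndex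
    ¬patternedCopy (f , _ , edges) = case trans (sym (edges a₀ b₀)) nonadjacent of λ ()
      where
      x : Fin k → ℕ
      x i = toℕ (f (inj₁ (inject≤ i k≤t)))

      b₀ : Fin t
      b₀ = inject≤ (funToFin (λ j → x j mod k)) k^k≤t

      y : ℕ
      y = toℕ (f (inj₂ b₀))

      a₀ : Fin t
      a₀ = inject≤ (y mod k) k≤t

      colour≡ : edgeColour a₀ b₀ ≡ (x (y mod k) + y) % k
      colour≡ = trans (cong₂ codeColour (toℕ-inject≤-mod (y mod k) k≤t) (toℕ-inject≤-mod _ k^k≤t))
                      (codeColour-funToFin x y)

      nonadjacent : adj (collection (edgeIndex (a₀ , b₀))) (f (inj₁ a₀)) (f (inj₂ b₀)) ≡ false
      nonadjacent = subst (λ G → adj G (f (inj₁ a₀)) (f (inj₂ b₀)) ≡ false) (sym (collection-edgeIndex a₀ b₀))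
                          (sumAvoiding-nonadjacent (edgeColour a₀ b₀) (f (inj₁ a₀)) (f (inj₂ b₀)) (sym colour≡))

proposition6p4 : ∀ (p q : ℕ) → 0 < p → 0 < q →
    ∃[ t₀ ] ∀ (t : ℕ) → t₀ ≤ t →
    ∃[ n₀ ] ∀ (n : ℕ) → n₀ ≤ n →
    Σ[ 𝔊 ∈ Collection (t * t) n ] Σ[ φ ∈ (EdgeKtt t → Fin (t * t)) ]
    (MinDegreeAtLeast 𝔊 p q × ¬ PatternedCopy t 𝔊 φ)
proposition6p4 p q 0<p 0<q = k ^ k + k , λ t t≥t₀ → 4 * q , λ n 4q≤n →
  let k≤t   = ≤-trans (m≤n+m k (k ^ k)) t≥t₀
      k^k≤t = ≤-trans (m≤m+n (k ^ k) k) t≥t₀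
  in  collection k k≤t k^k≤t , edgeIndex k k≤t k^k≤t
    , collection-minDegree k k≤t k^k≤t p q 0<p ≤-refl 4q≤n , ¬patternedCopy k k≤t k^k≤t
  where
  k : ℕ
  k = 4 * q

  instance
    k≢0 : NonZero k
    k≢0 = m*n≢0 4 q {{_}} {{>-nonZero 0<q}}
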